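{- Let $G=(V,E)$ be a thin connected digraph and let $x,y\in V$ satisfy $N^+[x]\subset N^+[y]$ or $N^-[x]\subset N^-[y]$ (proper inclusion). Then there is a walk in $\mathbb S(G)$ joining $x$ and $y$.
   Context: All digraphs are finite and simple without loops: $G=(V,E)$ with $E\subseteq\{(x,y)\in V\times V: x\neq y\}$; edges $(x,y)$ are written $xy$. Closed neighborhoods: $N^+[v]=\{x: vx\in E\}\cup\{v\}$, $N^-[v]=\{x: xv\in E\}\cup\{v\}$. A walk joining $x$ and $y$ is a sequence $x=x_0,\dots,x_n=y$ with $x_ix_{i+1}$ or $x_{i+1}x_i$ an edge for each $i$; a digraph is connected if any two vertices are joined by a walk. A digraph is thin if for all distinct vertices $x,y$, $N^+[x]\neq N^+[y]$ or $N^-[x]\neq N^-[y]$. In what follows $\subset$ denotes proper inclusion. For an edge $xy$ and a vertex $z$: $xy$ satisfies the $N^+$-condition with $z$ if $(1^+)$ $N^+[x]\subset N^+[z]\subset N^+[y]$, or $(2^+)$ $N^+[y]\subset N^+[z]\subset N^+[x]$, or $(3^+)$ $N^+[x]\cap N^+[y]\subset N^+[x]\cap N^+[z]$ and $N^+[x]\cap N^+[y]\subset N^+[y]\cap N^+[z]$; $xy$ satisfies the weak $N^+$-condition with $z$ if $N^+[x]\cap N^+[y]\subseteq N^+[x]\cap N^+[z]$ and $N^+[x]\cap N^+[y]\subseteq N^+[y]\cap N^+[z]$. The conditions $(1^-),(2^-),(3^-)$, the $N^-$-condition and the weak $N^-$-condition are defined identically with $N^-$ in place of $N^+$. An edge $xy$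 is dispensable if at least one holds: (D1) there is $z$ such that $xy$ satisfies the $N^+$-condition and the $N^-$-condition with $z$; (D2) there are $z_1,z_2$ such that (a) $xy$ satisfies $(3^+)$ with $z_1$ and the weak $N^-$-condition with $z_1$, and (b) $xy$ satisfies $(3^-)$ with $z_2$ and the weak $N^+$-condition with $z_2$; (D3) there is $z$ such that $xy$ satisfies the $N^+$-condition with $z$ and $N^-[x]=N^-[z]$ or $N^-[y]=N^-[z]$; (D4) there is $z$ such that $xy$ satisfies the $N^-$-condition with $z$ and $N^+[x]=N^+[z]$ or $N^+[y]=N^+[z]$; (D5) there are distinct vertices $z_1,z_2$, both distinct from $x$ and $y$, with $N^+[x]=N^+[z_1]$, $N^-[x]=N^-[z_2]$, $N^-[z_1]=N^-[y]$ and $N^+[z_2]=N^+[y]$. The Cartesian skeleton $\mathbb S(G)$ is the digraph with vertex set $V$ and edge set $E$ minus the set of dispensable edges. -}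

module Defs where

open import Data.Nat using (ℕ)
open import Data.Fin using (Fin)
open import Data.Product using (_×_; Σ; ∃; _,_)
open import Data.Sum using (_⊎_)
open import Relation.Nullary using (¬_)
open import Relation.Binary.PropositionalEquality using (_≡_)
open import Data.Bool using (Bool; true; false)

record Digraph : Set where
  field
    n     : ℕ
    adj   : Fin n → Fin n → Bool
    loopless : ∀ x → adj x x ≡ false
  V : Set
  V = Fin n
  E : V → V → Set
  E x y = adj x y ≡ true

module _ (G : Digraph) where
  open Digraph G

  VSet : Set₁
  VSet = V → Set

  _⊆_ : VSet → VSet → Set
  A ⊆ B = ∀ v → A v → B v

  _≐_ : VSet → VSet → Set
  A ≐ B = (A ⊆ B) × (B ⊆ A)

  _⊂_ : VSet → VSet → Set
  A ⊂ B = (A ⊆ B) × ¬ (B ⊆ A)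

  _∩_ : VSet → VSet → VSet
  (A ∩ B) v = A v × B v

  N⁺ : V → VSet
  N⁺ v x = E v x ⊎ x ≡ v

  N⁻ : V → VSet
  N⁻ v x = E x v ⊎ x ≡ v

  data WalkIn (R : V → V → Set) : V → V → Set where
    []    : ∀ {x} → WalkIn R x x
    fwd   : ∀ {x y z} → R x y → WalkIn R y z → WalkIn R x z
    bwd   : ∀ {x y z} → R y x → WalkIn R y z → WalkIn R x z

  Connected : Set
  Connected = ∀ x y → WalkIn E x y

  Thin : Set
  Thin = ∀ x y → ¬ x ≡ y → ¬ (N⁺ x ≐ N⁺ y) ⊎ ¬ (N⁻ x ≐ N⁻ y)

  cond1 cond2 cond3 weakCond NCond : (V → VSet) → V → V → V → Set
  cond1 N x y z = (N x ⊂ N z) × (N z ⊂ N y)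
  cond2 N x y z = (N y ⊂ N z) × (N z ⊂ N x)
  cond3 N x y z = ((N x ∩ N y) ⊂ (N x ∩ N z)) × ((N x ∩ N y) ⊂ (N y ∩ N z))
  weakCond N x y z = ((N x ∩ N y) ⊆ (N x ∩ N z)) × ((N x ∩ N y) ⊆ (N y ∩ N z))
  NCond N x y z = cond1 N x y z ⊎ cond2 N x y z ⊎ cond3 N x y z

  D1 D2 D3 D4 D5 : V → V → Set
  D1 x y = ∃ λ z → NCond N⁺ x y z × NCond N⁻ x y z
  D2 x y = (∃ λ z₁ → cond3 N⁺ x y z₁ × weakCond N⁻ x y z₁)
         × (∃ λ z₂ → cond3 N⁻ x y z₂ × weakCond N⁺ x y z₂)
  D3 x y = ∃ λ z → NCond N⁺ x y z × (N⁻ x ≐ N⁻ z ⊎ N⁻ y ≐ N⁻ z)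
  D4 x y = ∃ λ z → NCond N⁻ x y z × (N⁺ x ≐ N⁺ z ⊎ N⁺ y ≐ N⁺ z)
  D5 x y = Σ V λ z₁ → Σ V λ z₂ →
             ¬ z₁ ≡ z₂ × ¬ z₁ ≡ x × ¬ z₁ ≡ y × ¬ z₂ ≡ x × ¬ z₂ ≡ y
           × (N⁺ x ≐ N⁺ z₁) × (N⁻ x ≐ N⁻ z₂) × (N⁻ z₁ ≐ N⁻ y) × (N⁺ z₂ ≐ N⁺ y)

  -- the edge xy is dispensable (only meaningful for edges xy ∈ E)
  Dispensable : V → V → Set
  Dispensable x y = D1 x y ⊎ D2 x y ⊎ D3 x y ⊎ D4 x y ⊎ D5 x y

  SE : V → V → Set
  SE x y = E x y × ¬ Dispensable x y

  WalkInSkeleton : V → V → Set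
  WalkInSkeleton = WalkIn SE

module Submission where

-- Given A v ⊆ A u, where (A, B) is (N⁺, N⁻) or (N⁻, N⁺), we build a skeleton walk from u to v
-- by well-founded induction on the pair (u, v). For u ≢ v the vertex v lies in A u, so uv
-- (resp. vu) is an edge. Either it is not dispensable, or the clause making it dispensable
-- provides a vertex z with A v ⊆ A z ⊆ A u for which (u, z) and (z, v) both decrease the
-- lexicographic measure |A u ∖ A v|, |V ∖ (B u ∩ B v)|, |B u ∪ B v|; clause (D5) needs
-- thinness to exclude the cases where nothing decreases.

open import Data.Bool using (true)
import Data.Bool as Bool
open import Data.Empty using (⊥-elim)
open import Data.Fin using (Fin; _≟_)
open import Data.Fin.Properties using (any?; all?; ¬∀⟶∃¬)
open import Data.Fin.Subset using (Subset; _∈_; ∣_∣)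
open import Data.Fin.Subset.Properties using (p⊆q⇒∣p∣≤∣q∣; p⊂q⇒∣p∣<∣q∣)
open import Data.Nat using (ℕ; _≤_; _<_)
open import Data.Nat.Induction using (<-wellFounded)
open import Data.Nat.Properties using (m≤n⇒m<n∨m≡n)
open import Data.Product using (Σ; ∃; _×_; _,_; proj₁; proj₂; swap; uncurry)
open import Data.Product.Relation.Binary.Lex.Strict using (×-Lex; ×-wellFounded)
open import Data.Sum using (_⊎_; inj₁; inj₂; [_,_])
import Data.Sum as Sum
open import Data.Vec using (tabulate)
open import Data.Vec.Properties using (lookup∘tabulate; lookup⇒[]=; []=⇒lookup)
open import Function using (_∘_; _on_; id)
open import Induction.WellFounded using (WellFounded; Acc; acc)
open import Level using (Level; 0ℓ)
open import Relation.Binary using (Rel)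
import Relation.Binary.Construct.On as On
open import Relation.Binary.PropositionalEquality using (_≡_; _≢_; refl; sym; trans)
open import Relation.Nullary using (¬_; Dec; yes; no; does; contradiction)
open import Relation.Nullary.Decidable
  using (dec-true; dec-false; decidable-stable; _×-dec_; _⊎-dec_; _→-dec_; ¬?)
open import Relation.Unary using (Pred; Decidable; _⊆′_; _⊂′_; _≐′_; _∩_; _∪_; _∖_; ∁)
open import Relation.Unary.Properties
  using (_∩?_; _∪?_; ∁?; ⊆′-refl; ⊆′-trans; ⊂′-respˡ-≐′; ≐′-sym; ≐′-trans)

-- On vertex sets, the _⊆_, _⊂_, _≐_ and _∩_ of Defs are definitionally Relation.Unary's
-- _⊆′_, _⊂′_, _≐′_ and _∩_, in terms of which everything below is stated.
open import Defs hiding (_∩_)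

private variable
  ℓ : Level
  n : ℕ

module _ {P : Pred (Fin n) ℓ} (P? : Decidable P) where

  subset : Subset n
  subset = tabulate (does ∘ P?)

  ∈-subset⁺ : ∀ {x} → P x → x ∈ subset
  ∈-subset⁺ {x} p = lookup⇒[]= x subset (trans (lookup∘tabulate _ x) (dec-true (P? x) p))

  ∈-subset⁻ : ∀ {x} → x ∈ subset → P x
  ∈-subset⁻ {x} x∈ = decidable-stable (P? x) λ ¬p → contradiction
    (trans (sym ([]=⇒lookup x∈)) (trans (lookup∘tabulate _ x) (dec-false (P? x) ¬p))) λ ()

  #_ : ℕ
  #_ = ∣ subset ∣

module _ {P Q : Pred (Fin n) ℓ} (P? : Decidable P) (Q? : Decidable Q) where

  #-mono : P ⊆′ Q → # P? ≤ # Q?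
  #-mono P⊆Q = p⊆q⇒∣p∣≤∣q∣ (∈-subset⁺ Q? ∘ P⊆Q _ ∘ ∈-subset⁻ P?)

  #-mono-< : P ⊆′ Q → ∀ {x} → Q x → ¬ P x → # P? < # Q?
  #-mono-< P⊆Q {x} q ¬p = p⊂q⇒∣p∣<∣q∣
    ((∈-subset⁺ Q? ∘ P⊆Q _ ∘ ∈-subset⁻ P?) , x , ∈-subset⁺ Q? q , ¬p ∘ ∈-subset⁻ P?)

  ⊈′⇒∃ : ¬ (P ⊆′ Q) → ∃ λ x → P x × ¬ Q x
  ⊈′⇒∃ P⊈Q with ¬∀⟶∃¬ _ (λ x → P x → Q x) (λ x → P? x →-dec Q? x) P⊈Q
  ... | x , ¬[p→q] =
    x , decidable-stable (P? x) (λ ¬p → ¬[p→q] (λ p → contradiction p ¬p)) , λ q → ¬[p→q] λ _ → q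

  _⊆′?_ : Dec (P ⊆′ Q)
  _⊆′?_ = all? λ x → P? x →-dec Q? x

module _ {P Q : Pred (Fin n) ℓ} (P? : Decidable P) (Q? : Decidable Q) where

  _⊂′?_ : Dec (P ⊂′ Q)
  _⊂′?_ = (P? ⊆′? Q?) ×-dec ¬? (Q? ⊆′? P?)

  _≐′?_ : Dec (P ≐′ Q)
  _≐′?_ = (P? ⊆′? Q?) ×-dec (Q? ⊆′? P?)

∩-comm′ : {A : Set} {P Q : Pred A ℓ} → (P ∩ Q) ≐′ (Q ∩ P)
∩-comm′ = (λ _ → swap) , (λ _ → swap)

lex-≤ : ∀ {r} {B : Set} {_<ᵣ_ : Rel B r} {a a′ b b′} →
        a′ ≤ a → b′ <ᵣ b → ×-Lex _≡_ _<_ _<ᵣ_ (a′ , b′) (a , b)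
lex-≤ a′≤a b′<b with m≤n⇒m<n∨m≡n a′≤a
... | inj₁ a′<a = inj₁ a′<a
... | inj₂ refl = inj₂ (refl , b′<b)

module _ {G : Digraph} {R : Digraph.V G → Digraph.V G → Set} where

  infixr 5 _++_

  _++_ : ∀ {x y z} → WalkIn G R x y → WalkIn G R y z → WalkIn G R x z
  [] ++ q = q
  fwd r p ++ q = fwd r (p ++ q)
  bwd r p ++ q = bwd r (p ++ q)

  reverse : ∀ {x y} → WalkIn G R x y → WalkIn G R y x
  reverse [] = []
  reverse (fwd r p) = reverse p ++ bwd r []
  reverse (bwd r p) = reverse p ++ fwd r []

module Skeleton (G : Digraph) where
  open Digraph G

  E? : ∀ x y → Dec (E x y)
  E? x y = adj x y Bool.≟ true

  N⁺? : ∀ u → Decidable (N⁺ G u)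
  N⁺? u w = E? u w ⊎-dec w ≟ u

  N⁻? : ∀ u → Decidable (N⁻ G u)
  N⁻? u w = E? w u ⊎-dec w ≟ u

  module _ {N : V → VSet G} (N? : ∀ u → Decidable (N u)) where

    cond3? : ∀ x y z → Dec (cond3 G N x y z)
    cond3? x y z = (N? x ∩? N? y) ⊂′? (N? x ∩? N? z) ×-dec (N? x ∩? N? y) ⊂′? (N? y ∩? N? z)

    NCond? : ∀ x y z → Dec (NCond G N x y z)
    NCond? x y z = (N? x ⊂′? N? z ×-dec N? z ⊂′? N? y)
      ⊎-dec (N? y ⊂′? N? z ×-dec N? z ⊂′? N? x)
      ⊎-dec cond3? x y z

    weakCond? : ∀ x y z → Dec (weakCond G N x y z)
    weakCond? x y z = (N? x ∩? N? y) ⊆′? (N? x ∩? N? z) ×-dec (N? x ∩? N? y) ⊆′? (N? y ∩? N? z)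

  Dispensable? : ∀ x y → Dec (Dispensable G x y)
  Dispensable? x y =
          any? (λ z → NCond? N⁺? x y z ×-dec NCond? N⁻? x y z)
    ⊎-dec (any? (λ z → cond3? N⁺? x y z ×-dec weakCond? N⁻? x y z)
             ×-dec any? (λ z → cond3? N⁻? x y z ×-dec weakCond? N⁺? x y z))
    ⊎-dec any? (λ z → NCond? N⁺? x y z ×-dec (N⁻? x ≐′? N⁻? z ⊎-dec N⁻? y ≐′? N⁻? z))
    ⊎-dec any? (λ z → NCond? N⁻? x y z ×-dec (N⁺? x ≐′? N⁺? z ⊎-dec N⁺? y ≐′? N⁺? z))
    ⊎-dec any? λ z₁ → any? λ z₂ →
            ¬? (z₁ ≟ z₂) ×-dec ¬? (z₁ ≟ x) ×-dec ¬? (z₁ ≟ y) ×-dec ¬? (z₂ ≟ x) ×-dec ¬? (z₂ ≟ y)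
      ×-dec N⁺? x ≐′? N⁺? z₁ ×-dec N⁻? x ≐′? N⁻? z₂ ×-dec N⁻? z₁ ≐′? N⁻? y ×-dec N⁺? z₂ ≐′? N⁺? y

  NCond-swap : ∀ {N x y z} → NCond G N x y z → NCond G N y x z
  NCond-swap (inj₁ c₁) = inj₂ (inj₁ c₁)
  NCond-swap (inj₂ (inj₁ c₂)) = inj₁ c₂
  NCond-swap (inj₂ (inj₂ (xy⊂xz , xy⊂yz))) =
    inj₂ (inj₂ (⊂′-respˡ-≐′ ∩-comm′ xy⊂yz , ⊂′-respˡ-≐′ ∩-comm′ xy⊂xz))

  -- What can happen to the edge joining u and v when A v ⊆ A u: it survives in the skeleton, or
  -- it is dispensable and then the A-condition can only be (2) (between), the clause among
  -- (D3)/(D4) with the B-condition applies (twin), or (D5) applies (square).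
  data Reduction (A B : V → VSet G) (u v : V) : Set where
    direct  : WalkInSkeleton G u v → Reduction A B u v
    between : ∀ z → A v ⊂′ A z → A z ⊂′ A u → Reduction A B u v
    twin    : ∀ z → NCond G B u v z → A u ≐′ A z ⊎ A v ≐′ A z → Reduction A B u v
    square  : ∀ z₁ z₂ → z₁ ≢ v → z₂ ≢ v →
              A u ≐′ A z₁ → B z₁ ≐′ B v → B u ≐′ B z₂ → A z₂ ≐′ A v → Reduction A B u v

  NCond⇒Reduction : ∀ {A B u v z} → A v ⊆′ A u → NCond G A u v z → Reduction A B u v
  NCond⇒Reduction Av⊆Au (inj₁ ((_ , Az⊈Au) , (Az⊆Av , _))) =
    contradiction (⊆′-trans Az⊆Av Av⊆Au) Az⊈Au
  NCond⇒Reduction Av⊆Au (inj₂ (inj₁ (Av⊂Az , Az⊂Au))) = between _ Av⊂Az Az⊂Au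
  NCond⇒Reduction Av⊆Au (inj₂ (inj₂ (_ , (_ , Au∩Av⊉Av∩Az)))) =
    contradiction (λ w (av , _) → Av⊆Au w av , av) Au∩Av⊉Av∩Az

  module Walk {A B : V → VSet G} (A? : ∀ u → Decidable (A u)) (B? : ∀ u → Decidable (B u))
              (thin : ∀ x y → x ≢ y → ¬ (A x ≐′ A y) ⊎ ¬ (B x ≐′ B y)) where

    thin-≐ : ∀ {x y} → x ≢ y → A x ≐′ A y → ¬ (B x ≐′ B y)
    thin-≐ x≢y Ax≐Ay Bx≐By = [ contradiction Ax≐Ay , contradiction Bx≐By ] (thin _ _ x≢y)

    gap? : ∀ u v → Decidable (A u ∖ A v)
    gap? u v = A? u ∩? ∁? (A? v)

    notShared? : ∀ u v → Decidable (∁ (B u ∩ B v))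
    notShared? u v = ∁? (B? u ∩? B? v)

    covered? : ∀ u v → Decidable (B u ∪ B v)
    covered? u v = B? u ∪? B? v

    gap notShared covered : V → V → ℕ
    gap u v = # gap? u v
    notShared u v = # notShared? u v
    covered u v = # covered? u v

    gap-mono : ∀ {u v u′ v′} → A u′ ⊆′ A u → A v ⊆′ A v′ → gap u′ v′ ≤ gap u v
    gap-mono Au′⊆Au Av⊆Av′ =
      #-mono (gap? _ _) (gap? _ _) λ w (au′ , ¬av′) → Au′⊆Au w au′ , ¬av′ ∘ Av⊆Av′ w

    gap-mono-< : ∀ {u v u′ v′ w} → A u′ ⊆′ A u → A v ⊆′ A v′ →
                 A u w → ¬ A v w → ¬ (A u′ w × ¬ A v′ w) → gap u′ v′ < gap u v
    gap-mono-< Au′⊆Au Av⊆Av′ au ¬av =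
      #-mono-< (gap? _ _) (gap? _ _) (λ w (au′ , ¬av′) → Au′⊆Au w au′ , ¬av′ ∘ Av⊆Av′ w) (au , ¬av)

    notShared-mono : ∀ {u v u′ v′} → B u ∩ B v ⊆′ B u′ ∩ B v′ → notShared u′ v′ ≤ notShared u v
    notShared-mono shared⊆ =
      #-mono (notShared? _ _) (notShared? _ _) λ w ¬shared′ → ¬shared′ ∘ shared⊆ w

    notShared-mono-< : ∀ {u v u′ v′ w} → B u ∩ B v ⊆′ B u′ ∩ B v′ →
                       B u′ w → B v′ w → ¬ (B u w × B v w) → notShared u′ v′ < notShared u v
    notShared-mono-< shared⊆ bu′ bv′ ¬shared =
      #-mono-< (notShared? _ _) (notShared? _ _) (λ w ¬shared′ → ¬shared′ ∘ shared⊆ w)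
               ¬shared (λ ¬shared′ → ¬shared′ (bu′ , bv′))

    covered-mono-< : ∀ {u v u′ v′ w} → B u′ ∪ B v′ ⊆′ B u ∪ B v →
                     B u w ⊎ B v w → ¬ B u′ w → ¬ B v′ w → covered u′ v′ < covered u v
    covered-mono-< covered⊆ b ¬bu′ ¬bv′ =
      #-mono-< (covered? _ _) (covered? _ _) covered⊆ b [ ¬bu′ , ¬bv′ ]

    B-measure : V × V → ℕ × ℕ
    B-measure (u , v) = notShared u v , covered u v

    measure : V × V → ℕ × (V × V)
    measure (u , v) = gap u v , (u , v)

    _<ᴮ_ : Rel (V × V) 0ℓ
    _<ᴮ_ = ×-Lex _≡_ _<_ _<_ on B-measure

    _≺_ : Rel (V × V) 0ℓ
    _≺_ = ×-Lex _≡_ _<_ _<ᴮ_ on measure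

    ≺-wellFounded : WellFounded _≺_
    ≺-wellFounded = On.wellFounded measure
      (×-wellFounded <-wellFounded (On.wellFounded B-measure (×-wellFounded <-wellFounded <-wellFounded)))

    ≺-from-<ᴮ : ∀ {u v u′ v′} → gap u′ v′ ≤ gap u v → (u′ , v′) <ᴮ (u , v) →
                (u′ , v′) ≺ (u , v)
    ≺-from-<ᴮ = lex-≤ {_<ᵣ_ = _<ᴮ_}

    <ᴮ-from-covered : ∀ {u v u′ v′} → notShared u′ v′ ≤ notShared u v →
                      covered u′ v′ < covered u v → (u′ , v′) <ᴮ (u , v)
    <ᴮ-from-covered = lex-≤ {_<ᵣ_ = _<_}

    Split : V → V → Set
    Split u v = Σ V λ z → A z ⊆′ A u × A v ⊆′ A z × (u , z) ≺ (u , v) × (z , v) ≺ (u , v)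

    split-<ᴮ : ∀ {u v} z → A z ⊆′ A u → A v ⊆′ A z →
               (u , z) <ᴮ (u , v) → (z , v) <ᴮ (u , v) → Split u v
    split-<ᴮ z Az⊆Au Av⊆Az uz<uv zv<uv =
      z , Az⊆Au , Av⊆Az
      , ≺-from-<ᴮ (gap-mono ⊆′-refl Av⊆Az) uz<uv
      , ≺-from-<ᴮ (gap-mono Az⊆Au ⊆′-refl) zv<uv

    NCond⇒<ᴮ : ∀ {u v z} → NCond G B u v z → (u , z) <ᴮ (u , v) × (z , v) <ᴮ (u , v)
    NCond⇒<ᴮ {u} {v} {z} (inj₁ ((Bu⊆Bz , Bz⊈Bu) , (Bz⊆Bv , Bv⊈Bz)))
      with ⊈′⇒∃ (B? v) (B? z) Bv⊈Bz | ⊈′⇒∃ (B? z) (B? u) Bz⊈Bu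
    ... | w , bv , ¬bz | w′ , bz , ¬bu =
      <ᴮ-from-covered (notShared-mono λ _ (bu , _) → bu , Bu⊆Bz _ bu)
                      (covered-mono-< (λ _ → Sum.map₂ (Bz⊆Bv _)) (inj₂ bv) (¬bz ∘ Bu⊆Bz w) ¬bz)
      , inj₁ (notShared-mono-< (λ _ (bu , bv) → Bu⊆Bz _ bu , bv) bz (Bz⊆Bv w′ bz) (¬bu ∘ proj₁))
    NCond⇒<ᴮ {u} {v} {z} (inj₂ (inj₁ ((Bv⊆Bz , Bz⊈Bv) , (Bz⊆Bu , Bu⊈Bz))))
      with ⊈′⇒∃ (B? z) (B? v) Bz⊈Bv | ⊈′⇒∃ (B? u) (B? z) Bu⊈Bz
    ... | w , bz , ¬bv | w′ , bu , ¬bz =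
      inj₁ (notShared-mono-< (λ _ (bu , bv) → bu , Bv⊆Bz _ bv) (Bz⊆Bu w bz) bz (¬bv ∘ proj₂))
      , <ᴮ-from-covered (notShared-mono λ _ (_ , bv) → Bv⊆Bz _ bv , bv)
                        (covered-mono-< (λ _ → Sum.map₁ (Bz⊆Bu _)) (inj₁ bu) ¬bz (¬bz ∘ Bv⊆Bz w′))
    NCond⇒<ᴮ {u} {v} {z} (inj₂ (inj₂ ((uv⊆uz , uz⊈uv) , (uv⊆vz , vz⊈uv))))
      with ⊈′⇒∃ (B? u ∩? B? z) (B? u ∩? B? v) uz⊈uv | ⊈′⇒∃ (B? v ∩? B? z) (B? u ∩? B? v) vz⊈uv
    ... | _ , (bu , bz) , ¬uv | _ , (bv , bz′) , ¬uv′ =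
      inj₁ (notShared-mono-< uv⊆uz bu bz ¬uv)
      , inj₁ (notShared-mono-< (λ w → swap ∘ uv⊆vz w) bz′ bv ¬uv′)

    between⇒Split : ∀ {u v} z → A v ⊂′ A z → A z ⊂′ A u → Split u v
    between⇒Split {u} {v} z (Av⊆Az , Az⊈Av) (Az⊆Au , Au⊈Az)
      with ⊈′⇒∃ (A? z) (A? v) Az⊈Av | ⊈′⇒∃ (A? u) (A? z) Au⊈Az
    ... | w , az , ¬av | w′ , au , ¬az =
      z , Az⊆Au , Av⊆Az
      , inj₁ (gap-mono-< ⊆′-refl Av⊆Az (Az⊆Au w az) ¬av λ (_ , ¬az′) → ¬az′ az)
      , inj₁ (gap-mono-< Az⊆Au ⊆′-refl au (¬az ∘ Av⊆Az w′) λ (az′ , _) → ¬az az′)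

    twin⇒Split : ∀ {u v} z → A v ⊆′ A u → NCond G B u v z → A u ≐′ A z ⊎ A v ≐′ A z → Split u v
    twin⇒Split z Av⊆Au c (inj₁ (Au⊆Az , Az⊆Au)) =
      uncurry (split-<ᴮ z Az⊆Au (⊆′-trans Av⊆Au Au⊆Az)) (NCond⇒<ᴮ c)
    twin⇒Split z Av⊆Au c (inj₂ (Av⊆Az , Az⊆Av)) =
      uncurry (split-<ᴮ z (⊆′-trans Az⊆Av Av⊆Au) Av⊆Az) (NCond⇒<ᴮ c)

    ≐-gap-< : ∀ {u v z} → A u ≐′ A z → ¬ (A u ⊆′ A v) → gap u z < gap u v
    ≐-gap-< {u} {v} (Au⊆Az , _) Au⊈Av with ⊈′⇒∃ (A? u) (A? v) Au⊈Av
    ... | w , au , ¬av = #-mono-< (gap? _ _) (gap? _ _)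
      (λ w′ (au′ , ¬az′) → ⊥-elim (¬az′ (Au⊆Az w′ au′))) (au , ¬av) λ (_ , ¬az) → ¬az (Au⊆Az w au)

    ≐-<ᴮ : ∀ {u v z} → B z ≐′ B v → ¬ (B u ≐′ B v) → (z , v) <ᴮ (u , v)
    ≐-<ᴮ {u} {v} {z} (Bz⊆Bv , Bv⊆Bz) Bu≉Bv with B? v ⊆′? B? u
    ... | no Bv⊈Bu with ⊈′⇒∃ (B? v) (B? u) Bv⊈Bu
    ...   | w , bv , ¬bu = inj₁ (notShared-mono-< shared⊆ (Bv⊆Bz w bv) bv (¬bu ∘ proj₁))
      where
      shared⊆ : B u ∩ B v ⊆′ B z ∩ B v
      shared⊆ _ (_ , bv) = Bv⊆Bz _ bv , bv
    ≐-<ᴮ {u} {v} {z} (Bz⊆Bv , Bv⊆Bz) Bu≉Bv | yes Bv⊆Bu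
      with ⊈′⇒∃ (B? u) (B? v) (λ Bu⊆Bv → Bu≉Bv (Bu⊆Bv , Bv⊆Bu))
    ... | w , bu , ¬bv =
      <ᴮ-from-covered (notShared-mono λ _ (_ , bv) → Bv⊆Bz _ bv , bv)
                      (covered-mono-< covered⊆ (inj₁ bu) (¬bv ∘ Bz⊆Bv w) ¬bv)
      where
      covered⊆ : B z ∪ B v ⊆′ B u ∪ B v
      covered⊆ _ = inj₂ ∘ [ Bz⊆Bv _ , id ]

    square⇒Split : ∀ {u v} z₁ z₂ → z₁ ≢ v → z₂ ≢ v → A v ⊆′ A u →
                   A u ≐′ A z₁ → B z₁ ≐′ B v → B u ≐′ B z₂ → A z₂ ≐′ A v → Split u v
    square⇒Split {u} {v} z₁ z₂ z₁≢v z₂≢v Av⊆Au Au≐Az₁@(Au⊆Az₁ , Az₁⊆Au) Bz₁≐Bv Bu≐Bz₂ Az₂≐Av =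
      z₁ , Az₁⊆Au , Av⊆Az₁
      , inj₁ (≐-gap-< Au≐Az₁ Au⊈Av)
      , ≺-from-<ᴮ (gap-mono Az₁⊆Au ⊆′-refl) (≐-<ᴮ Bz₁≐Bv Bu≉Bv)
      where
      Av⊆Az₁ : A v ⊆′ A z₁
      Av⊆Az₁ = ⊆′-trans Av⊆Au Au⊆Az₁

      Au⊈Av : ¬ (A u ⊆′ A v)
      Au⊈Av Au⊆Av = thin-≐ z₁≢v (⊆′-trans Az₁⊆Au Au⊆Av , Av⊆Az₁) Bz₁≐Bv

      Bu≉Bv : ¬ (B u ≐′ B v)
      Bu≉Bv Bu≐Bv = thin-≐ z₂≢v Az₂≐Av (≐′-trans (≐′-sym Bu≐Bz₂) Bu≐Bv)

    reduce : ∀ {u v} → A v ⊆′ A u → Reduction A B u v → WalkInSkeleton G u v ⊎ Split u v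
    reduce _ (direct w) = inj₁ w
    reduce _ (between z Av⊂Az Az⊂Au) = inj₂ (between⇒Split z Av⊂Az Az⊂Au)
    reduce Av⊆Au (twin z c eq) = inj₂ (twin⇒Split z Av⊆Au c eq)
    reduce Av⊆Au (square z₁ z₂ z₁≢v z₂≢v e₁ e₂ e₃ e₄) =
      inj₂ (square⇒Split z₁ z₂ z₁≢v z₂≢v Av⊆Au e₁ e₂ e₃ e₄)

    walk : (∀ {u v} → u ≢ v → A v ⊆′ A u → Reduction A B u v) →
           ∀ {u v} → A v ⊆′ A u → WalkInSkeleton G u v
    walk reduction {u} {v} = go u v (≺-wellFounded (u , v))
      where
      go : ∀ u v → Acc _≺_ (u , v) → A v ⊆′ A u → WalkInSkeleton G u v
      go u v (acc rec) Av⊆Au with u ≟ v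
      ... | yes refl = []
      ... | no u≢v with reduce Av⊆Au (reduction u≢v Av⊆Au)
      ...   | inj₁ uv = uv
      ...   | inj₂ (z , Az⊆Au , Av⊆Az , uz≺uv , zv≺uv) =
        go u z (rec uz≺uv) Az⊆Au ++ go z v (rec zv≺uv) Av⊆Az

  reduction⁺ : ∀ {u v} → u ≢ v → N⁺ G v ⊆′ N⁺ G u → Reduction (N⁺ G) (N⁻ G) u v
  reduction⁺ {u} {v} u≢v Nv⊆Nu with Nv⊆Nu v (inj₂ refl)
  ... | inj₂ v≡u = contradiction (sym v≡u) u≢v
  ... | inj₁ uv with Dispensable? u v
  ... | no ¬d = direct (fwd (uv , ¬d) [])
  ... | yes (inj₁ (_ , c , _)) = NCond⇒Reduction Nv⊆Nu c
  ... | yes (inj₂ (inj₁ ((_ , c , _) , _))) = NCond⇒Reduction Nv⊆Nu (inj₂ (inj₂ c))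
  ... | yes (inj₂ (inj₂ (inj₁ (_ , c , _)))) = NCond⇒Reduction Nv⊆Nu c
  ... | yes (inj₂ (inj₂ (inj₂ (inj₁ (z , c , eq))))) = twin z c eq
  ... | yes (inj₂ (inj₂ (inj₂ (inj₂ (z₁ , z₂ , _ , _ , z₁≢v , _ , z₂≢v , e₁ , e₂ , e₃ , e₄))))) =
    square z₁ z₂ z₁≢v z₂≢v e₁ e₃ e₂ e₄

  reduction⁻ : ∀ {u v} → u ≢ v → N⁻ G v ⊆′ N⁻ G u → Reduction (N⁻ G) (N⁺ G) u v
  reduction⁻ {u} {v} u≢v Nv⊆Nu with Nv⊆Nu v (inj₂ refl)
  ... | inj₂ v≡u = contradiction (sym v≡u) u≢v
  ... | inj₁ vu with Dispensable? v u
  ... | no ¬d = direct (bwd (vu , ¬d) [])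
  ... | yes (inj₁ (_ , _ , c)) = NCond⇒Reduction Nv⊆Nu (NCond-swap {N = N⁻ G} c)
  ... | yes (inj₂ (inj₁ (_ , (_ , c , _)))) =
    NCond⇒Reduction Nv⊆Nu (NCond-swap {N = N⁻ G} (inj₂ (inj₂ c)))
  ... | yes (inj₂ (inj₂ (inj₁ (z , c , eq)))) = twin z (NCond-swap {N = N⁺ G} c) (Sum.swap eq)
  ... | yes (inj₂ (inj₂ (inj₂ (inj₁ (_ , c , _))))) = NCond⇒Reduction Nv⊆Nu (NCond-swap {N = N⁻ G} c)
  ... | yes (inj₂ (inj₂ (inj₂ (inj₂ (z₁ , z₂ , _ , z₁≢v , _ , z₂≢v , _ , e₁ , e₂ , e₃ , e₄))))) =
    square z₁ z₂ z₁≢v z₂≢v (≐′-sym e₃) (≐′-sym e₁) (≐′-sym e₄) (≐′-sym e₂)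

  walk⁺ : Thin G → ∀ {u v} → N⁺ G v ⊆′ N⁺ G u → WalkInSkeleton G u v
  walk⁺ thin = Walk.walk N⁺? N⁻? thin reduction⁺

  walk⁻ : Thin G → ∀ {u v} → N⁻ G v ⊆′ N⁻ G u → WalkInSkeleton G u v
  walk⁻ thin = Walk.walk N⁻? N⁺? (λ x y → Sum.swap ∘ thin x y) reduction⁻

lemma15 : (G : Digraph) → Thin G → Connected G →
          (x y : Digraph.V G) →
          _⊂_ G (N⁺ G x) (N⁺ G y) ⊎ _⊂_ G (N⁻ G x) (N⁻ G y) →
          WalkInSkeleton G x y
lemma15 G thin _ x y (inj₁ (N⁺x⊆N⁺y , _)) = reverse (Skeleton.walk⁺ G thin N⁺x⊆N⁺y)
lemma15 G thin _ x y (inj₂ (N⁻x⊆N⁻y , _)) = reverse (Skeleton.walk⁻ G thin N⁻x⊆N⁻y)
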